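{- Let $\mathcal X=(\Omega,S)$ be a quasiregular coherent configuration with fibers $\Omega_i$, $i\in I$, let $S_{ij}=\{s\in S:s\subseteq\Omega_i\times\Omega_j\}$, $G_i=S_{ii}$, and $G_{ij}=\ker(\pi_{ij})$ where $\pi_{ij}:G_i\to\mathrm{Sym}(S_{ij})$, $x^{\pi_{ij}(s)}=s^*\cdot x$. Choose points $\alpha_i\in\Omega_i$ and let $s_{ij}\in S$ be the basis relation containing $(\alpha_i,\alpha_j)$. Then for all $i,j\in I$ the map $f_{ij}:G_i/G_{ij}\to G_j/G_{ji}$, $G_{ij}s\mapsto s_{ij}^*(G_{ij}s)s_{ij}$ (complex product) is a well-defined group isomorphism, and $f_{ij}^{ -1}=f_{ji}$.
   Context: A coherent configuration is a pair $(\Omega,S)$ where $\Omega$ is a finite set and $S$ is a partition of $\Omega\times\Omega$ (basis relations) such that $1_\Omega$ is a union of basis relations, $s^*=\{(\beta,\alpha):(\alpha,\beta)\in s\}\in S$ for all $s\in S$, and for all $r,s,t\in S$ the number $|\alpha r\cap\beta s^*|$ is independent of $(\alpha,\beta)\in t$. A fiber is a set $\Delta$ with $1_\Delta\in S$. A relation $s$ is thin if $|\alpha s|\le1$ and $|\alpha s^*|\le1$ for all $\alpha$, where $\alpha s=\{\beta:(\alpha,\beta)\in s\}$. The configuration is quasiregular if for each fiber $\Delta$ all basis relations contained in $\Delta\times\Delta$ are thin; then each $G_i$ is a group under composition $r\cdot s=\{(\alpha,\beta):(\alpha,\gamma)\in r,(\gamma,\beta)\in s\text{ for some }\gamma\}$.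 For basis relations $r,s$, the complex product $rs$ is the set of basis relations contained in $r\cdot s$, extended to sets by $XY=\bigcup_{r\in X,s\in Y}rs$. -}

module Defs where

open import Data.Nat using (ℕ; zero; suc; _+_)
open import Data.Fin using (Fin; zero; suc; _≟_)
open import Data.Bool using (Bool; true; false; if_then_else_; _∧_)
open import Data.Product using (Σ; ∃; ∃-syntax; _×_; _,_)
open import Relation.Nullary.Decidable using (⌊_⌋)
open import Relation.Binary.PropositionalEquality using (_≡_)

-- A configuration on Ω = Fin n with (at most) m basis relations is given by a
-- colouring  c : Ω → Ω → Fin m ; the basis relation with colour u is
-- { (a,b) : c a b ≡ u }.  Surjectivity of c makes every colour class a
-- (nonempty) cell of the partition S of Ω × Ω.

Colouring : ℕ → ℕ → Set
Colouring n m = Fin n → Fin n → Fin m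

count : ∀ {n} → (Fin n → Bool) → ℕ
count {zero} P = 0
count {suc n} P = (if P zero then 1 else 0) + count (λ x → P (suc x))

module _ {n m : ℕ} (c : Colouring n m) where

  interNum : Fin m → Fin m → Fin n → Fin n → ℕ
  interNum r s a b = count (λ γ → ⌊ c a γ ≟ r ⌋ ∧ ⌊ c γ b ≟ s ⌋)

  record IsCoherent : Set where
    field
      surj      : ∀ (u : Fin m) → Σ (Fin n) λ a → Σ (Fin n) λ b → c a b ≡ u
      -- 1_Ω is a union of basis relations
      diagonal  : ∀ (a b b' : Fin n) → c a a ≡ c b b' → b ≡ b'
      transpose : ∀ (a b a' b' : Fin n) → c a b ≡ c a' b' → c b a ≡ c b' a'
      intersection : ∀ (r s : Fin m) (a b a' b' : Fin n) →
                     c a b ≡ c a' b' → interNum r s a b ≡ interNum r s a' b'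

  -- colour i is (the colour of 1_Δ for) a fiber Δ = { x : c x x ≡ i }
  IsFiber : Fin m → Set
  IsFiber i = Σ (Fin n) λ x → c x x ≡ i

  InS : Fin m → Fin m → Fin m → Set
  InS i j s = ∀ (a b : Fin n) → c a b ≡ s → (c a a ≡ i × c b b ≡ j)

  InG : Fin m → Fin m → Set
  InG i s = InS i i s

  Thin : Fin m → Set
  Thin s = (∀ (a b b' : Fin n) → c a b ≡ s → c a b' ≡ s → b ≡ b')
         × (∀ (a a' b : Fin n) → c a b ≡ s → c a' b ≡ s → a ≡ a')

  IsQuasiregular : Set
  IsQuasiregular = ∀ (i s : Fin m) → IsFiber i → InS i i s → Thin s

  -- G_ij = ker π_ij : those s ∈ G_i with  s* · x = x  (as relations) for all x ∈ S_ij
  InKer : Fin m → Fin m → Fin m → Set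
  InKer i j s = InG i s ×
    (∀ (x : Fin m) → InS i j x → ∀ (a b : Fin n) →
       ((Σ (Fin n) λ γ → c γ a ≡ s × c γ b ≡ x) → c a b ≡ x) ×
       (c a b ≡ x → Σ (Fin n) λ γ → c γ a ≡ s × c γ b ≡ x))

  CSet : Set₁
  CSet = Fin m → Set

  SubComp : Fin m → Fin m → Fin m → Set
  SubComp u r s = ∀ (a b : Fin n) → c a b ≡ u → Σ (Fin n) λ γ → c a γ ≡ r × c γ b ≡ s

  Cplx : CSet → CSet → CSet
  Cplx X Y u = Σ (Fin m) λ r → Σ (Fin m) λ s → X r × Y s × SubComp u r s

  Sgl : Fin m → CSet
  Sgl s t = t ≡ s

  SglT : Fin m → CSet
  SglT s t = ∀ (a b : Fin n) → (c a b ≡ t → c b a ≡ s) × (c b a ≡ s → c a b ≡ t)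

  Coset : Fin m → Fin m → Fin m → CSet
  Coset i j s = Cplx (InKer i j) (Sgl s)

  fmap : (Fin m → Fin n) → Fin m → Fin m → CSet → CSet
  fmap α i j X = Cplx (SglT (c (α i) (α j))) (Cplx X (Sgl (c (α i) (α j))))

  _≐_ : CSet → CSet → Set
  X ≐ Y = ∀ (u : Fin m) → (X u → Y u) × (Y u → X u)

module Submission where

-- The proof works with points rather than relations.
--  * Coherence: whether a pair (a , b) is joined by a path with prescribed
--    colours depends only on the colour of (a , b)  (path-transfer).
--  * Quasiregularity: relations inside a fibre are thin, so the colour of
--    (a , d) is determined by the colours of (a , b) and (b , d) when a and b
--    lie in one fibre  (thin-composite).
--  * The kernel G_xy is described by agreement: c a a' ∈ G_xy iff a and a' see
--    every point of the fibre y in the same colour, and agreement at one point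
--    of y already implies it on all of y  (agree-spread, agree⇔kernel).
--  * Hence cosets G_xy s are unions of agreement classes on both sides
--    (coset-agree), and the three claims of the lemma (image of a coset is a
--    coset, multiplicativity, inverse) become short point chases.

open import Defs
open import Data.Nat using (ℕ; zero; suc)
open import Data.Fin using (Fin; zero; suc; _≟_)
open import Data.Bool using (Bool; true; false; T; _∧_)
open import Data.Bool.Properties using (T-∧)
open import Data.Unit using (tt)
open import Data.Product using (Σ; ∃; _×_; _,_; proj₁; proj₂)
open import Data.Empty using (⊥-elim)
open import Function using (_∘_; Equivalence)
open import Relation.Nullary.Decidable using (⌊_⌋; toWitness; fromWitness)
open import Relation.Binary.PropositionalEquality
  using (_≡_; _≢_; refl; sym; trans; subst)

witness⇒count≢0 : ∀ {n} (P : Fin n → Bool) (x : Fin n) → T (P x) → count P ≢ 0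
witness⇒count≢0 P zero Px with P zero
witness⇒count≢0 P zero Px | true  = λ ()
witness⇒count≢0 P zero () | false
witness⇒count≢0 P (suc x) Px with P zero
... | true  = λ ()
... | false = witness⇒count≢0 (P ∘ suc) x Px

count≢0⇒witness : ∀ {n} (P : Fin n → Bool) → count P ≢ 0 → ∃ λ x → T (P x)
count≢0⇒witness {zero}  P h = ⊥-elim (h refl)
count≢0⇒witness {suc n} P h with P zero in P0
... | true  = zero , subst T (sym P0) tt
... | false = let (x , Px) = count≢0⇒witness (P ∘ suc) h in suc x , Px

module Coherent {n m : ℕ} (c : Colouring n m) (coh : IsCoherent c) where
  open IsCoherent coh

  Path : Fin m → Fin m → Fin n → Fin n → Set
  Path r s a b = Σ (Fin n) λ γ → c a γ ≡ r × c γ b ≡ s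

  -- The number of such paths is an intersection number, so their existence
  -- depends only on the colour of (a , b).
  path-transfer : ∀ {r s a b a' b'} → c a b ≡ c a' b' → Path r s a b → Path r s a' b'
  path-transfer {r} {s} {a} {b} {a'} {b'} e (γ , aγ , γb) =
    let (δ , onδ) = count≢0⇒witness (on-path a' b') λ none →
                      witness⇒count≢0 (on-path a b) γ (path⇒on aγ γb)
                        (trans (intersection r s a b a' b' e) none)
    in δ , on⇒path onδ
    where
    on-path : Fin n → Fin n → Fin n → Bool
    on-path x y δ = ⌊ c x δ ≟ r ⌋ ∧ ⌊ c δ y ≟ s ⌋

    path⇒on : ∀ {x y δ} → c x δ ≡ r → c δ y ≡ s → T (on-path x y δ)
    path⇒on {x} {y} {δ} xδ δy =
      Equivalence.from (T-∧ {⌊ c x δ ≟ r ⌋} {⌊ c δ y ≟ s ⌋}) (fromWitness xδ , fromWitness δy)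

    on⇒path : ∀ {x y δ} → T (on-path x y δ) → c x δ ≡ r × c δ y ≡ s
    on⇒path {x} {y} {δ} on =
      let (xδ , δy) = Equivalence.to (T-∧ {⌊ c x δ ≟ r ⌋} {⌊ c δ y ≟ s ⌋}) on
      in toWitness {a? = c x δ ≟ r} xδ , toWitness {a? = c δ y ≟ s} δy

  source-fibre : ∀ {a b a' b'} → c a b ≡ c a' b' → c a a ≡ c a' a'
  source-fibre {a} {b} {a'} {b'} e =
    let (δ , a'δ , _) = path-transfer e (a , refl , refl)
        δ≡a' = sym (diagonal a a' δ (sym a'δ))
    in sym (subst (λ x → c a' x ≡ c a a) δ≡a' a'δ)

  target-fibre : ∀ {a b a' b'} → c a b ≡ c a' b' → c b b ≡ c b' b'
  target-fibre {a} {b} {a'} {b'} e = source-fibre (transpose a b a' b' e)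

  extend : ∀ {a a₀ b₀} → c a a ≡ c a₀ a₀ → Σ (Fin n) λ b → c a b ≡ c a₀ b₀
  extend {a} {a₀} {b₀} e =
    let (b , ab , _) = path-transfer (sym e) (b₀ , refl , refl) in b , ab

  ≐-by-pairs : {X Y : CSet c} → (∀ a b → X (c a b) → Y (c a b)) →
               (∀ a b → Y (c a b) → X (c a b)) → _≐_ c X Y
  ≐-by-pairs {X} {Y} to from u =
    let (a , b , ab) = surj u
    in (λ Xu → subst Y ab (to a b (subst X (sym ab) Xu))) ,
       (λ Yu → subst X ab (from a b (subst Y (sym ab) Yu)))

  Cplx-intro : ∀ {X Y : CSet c} {a g b} → X (c a g) → Y (c g b) → Cplx c X Y (c a b)
  Cplx-intro {a = a} {g} {b} Xag Ygb =
    c a g , c g b , Xag , Ygb , λ x y xy → path-transfer (sym xy) (g , refl , refl)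

  Cplx-elim : ∀ {X Y : CSet c} {a b} → Cplx c X Y (c a b) →
              Σ (Fin n) λ g → X (c a g) × Y (c g b)
  Cplx-elim {X} {Y} {a} {b} (_ , _ , Xr , Ys , sub) =
    let (g , ag , gb) = sub a b refl in g , subst X (sym ag) Xr , subst Y (sym gb) Ys

  Conj : Fin m → CSet c → CSet c
  Conj σ X = Cplx c (SglT c σ) (Cplx c X (Sgl c σ))

  transpose-singleton : ∀ {σ g e} → c g e ≡ σ → SglT c σ (c e g)
  transpose-singleton {σ} {g} {e} ge a b =
    (λ ab → trans (transpose a b e g ab) ge) ,
    (λ ba → transpose b a g e (trans ba (sym ge)))

  conj-intro : ∀ {σ} {X : CSet c} {e g l f} →
               c g e ≡ σ → X (c g l) → c l f ≡ σ → Conj σ X (c e f)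
  conj-intro {X = X} ge Xgl lf =
    Cplx-intro (transpose-singleton ge) (Cplx-intro {X = X} Xgl lf)

  conj-elim : ∀ {σ} {X : CSet c} {e f} → Conj σ X (c e f) →
              Σ (Fin n) λ g → Σ (Fin n) λ l → c g e ≡ σ × X (c g l) × c l f ≡ σ
  conj-elim {σ} {X} {e} h =
    let (g , σ*eg , σg-f) = Cplx-elim {X = SglT c σ} h
        (l , Xgl , lf) = Cplx-elim {X = X} {Y = Sgl c σ} σg-f
    in g , l , proj₁ (σ*eg e g) refl , Xgl , lf

module Quasiregular {n m : ℕ} (c : Colouring n m) (coh : IsCoherent c)
                    (qr : IsQuasiregular c) where
  open IsCoherent coh
  open Coherent c coh public

  thin : ∀ {a b} → c a a ≡ c b b → Thin c (c a b)
  thin {a} {b} e = qr (c a a) (c a b) (a , refl)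
    λ x y xy → source-fibre xy , trans (target-fibre xy) (sym e)

  -- For a, b in one fibre, the thin relation c a b composed with c b d is a
  -- single basis relation: the colour of (a , d) is determined.
  thin-composite : ∀ {a b d a' b' d'} → c a a ≡ c b b →
                   c a b ≡ c a' b' → c b d ≡ c b' d' → c a d ≡ c a' d'
  thin-composite {a} {b} {d} {a'} {b'} {d'} ab-fibre ab bd =
    let (δ , b'δ , δd') = path-transfer bd (a , refl , refl)
        δ≡a' = proj₁ (thin (sym ab-fibre)) b' δ a' b'δ (sym (transpose a b a' b' ab))
    in sym (subst (λ x → c x d' ≡ c a d) δ≡a' δd')

  Agree : Fin m → Fin n → Fin n → Set
  Agree y a a' = ∀ d → c d d ≡ y → c a d ≡ c a' d

  agree-refl : ∀ {y a} → Agree y a a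
  agree-refl _ _ = refl

  agree-trans : ∀ {y a a' a''} → Agree y a a' → Agree y a' a'' → Agree y a a''
  agree-trans aa' a'a'' d dy = trans (aa' d dy) (a'a'' d dy)

  agree-spread : ∀ {y a a' γ} → c a γ ≡ c a' γ → c γ γ ≡ y → Agree y a a'
  agree-spread {a = a} {a'} {γ} aγ γy d dy =
    transpose d a d a' (thin-composite (trans dy (sym γy)) refl (transpose a γ a' γ aγ))

  agree-transfer : ∀ {y a a' b b'} → c a a' ≡ c b b' → Agree y a a' → Agree y b b'
  agree-transfer {a = a} {a'} {b} {b'} e aa' d dy =
    let (δ , bδ , δb') = path-transfer e (d , refl , refl)
        bδ≡b'δ = trans bδ (trans (aa' d dy) (transpose d a' δ b' (sym δb')))
    in agree-spread bδ≡b'δ (trans (target-fibre bδ) dy) d dy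

  agree⇒kernel : ∀ {x y a a'} → c a a ≡ x → c a' a' ≡ x → Agree y a a' →
                 InKer c x y (c a a')
  agree⇒kernel {x} {y} {a} {a'} ax a'x aa' =
    (λ u v uv → trans (source-fibre uv) ax , trans (target-fibre uv) a'x) ,
    λ z z∈S b d → moves-into z z∈S b d , moves-from z z∈S b d
    where
    moves-into : ∀ z → InS c x y z → ∀ b d →
                 (Σ (Fin n) λ γ → c γ b ≡ c a a' × c γ d ≡ z) → c b d ≡ z
    moves-into z z∈S b d (γ , γb , γd) =
      trans (sym (agree-transfer (sym γb) aa' d (proj₂ (z∈S γ d γd)))) γd
    moves-from : ∀ z → InS c x y z → ∀ b d → c b d ≡ z →
                 Σ (Fin n) λ γ → c γ b ≡ c a a' × c γ d ≡ z
    moves-from z z∈S b d bd =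
      let (b∈x , d∈y) = z∈S b d bd
          (γ , bγ) = extend {b} {a'} {a} (trans b∈x (sym a'x))
          γb = transpose b γ a' a bγ
      in γ , γb , trans (agree-transfer (sym γb) aa' d d∈y) bd

  kernel⇒agree : ∀ {x y a a'} → InKer c x y (c a a') → Agree y a a'
  kernel⇒agree {x} {y} {a} {a'} (inG , trivial) d dy =
    let ad∈S : InS c x y (c a d)
        ad∈S u v uv = trans (source-fibre uv) (proj₁ (inG a a' refl)) ,
                      trans (target-fibre uv) dy
    in sym (proj₁ (trivial (c a d) ad∈S a' d) (a , refl , refl))

  coset-intro : ∀ {x y s a a' b} → c a a ≡ x → c a' a' ≡ x → Agree y a a' →
                c a' b ≡ s → Coset c x y s (c a b)
  coset-intro ax a'x aa' a'b = Cplx-intro (agree⇒kernel ax a'x aa') a'b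

  coset-elim : ∀ {x y s a b} → Coset c x y s (c a b) →
               Σ (Fin n) λ a' → c a a ≡ x × c a' a' ≡ x × Agree y a a' × c a' b ≡ s
  coset-elim {y = y} coset =
    let (a' , ker , a'b) = Cplx-elim {X = InKer c _ y} coset
        (ax , a'x) = proj₁ ker _ a' refl
    in a' , ax , a'x , kernel⇒agree ker , a'b

  coset-fibres : ∀ {x y s a b} → InG c x s → Coset c x y s (c a b) →
                 c a a ≡ x × c b b ≡ x
  coset-fibres s∈G coset =
    let (a' , ax , _ , _ , a'b) = coset-elim coset in ax , proj₂ (s∈G a' _ a'b)

  -- Cosets are unions of agreement classes on both sides: G_xy s G_xy = G_xy s.
  coset-agree : ∀ {x y s a a' b b'} → c a a ≡ x → c b b ≡ x → c b' b' ≡ x →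
                Agree y a a' → Agree y b b' → Coset c x y s (c a' b') →
                Coset c x y s (c a b)
  coset-agree {a = a} {a'} {b} {b'} ax bx b'x aa' bb' coset =
    let (a'' , _ , a''x , a'a'' , a''b') = coset-elim coset
        (e , be) = extend {b} {b'} {a''} (trans bx (sym b'x))
        eb = transpose b e b' a'' be
        a''e : Agree _ a'' e
        a''e d dy = thin-composite (trans a''x (sym b'x)) (sym eb) (sym (bb' d dy))
    in coset-intro ax (trans (target-fibre be) a''x)
                   (agree-trans aa' (agree-trans a'a'' a''e)) (trans eb a''b')

module Isomorphism {n m : ℕ} (c : Colouring n m) (coh : IsCoherent c)
                   (qr : IsQuasiregular c) {i j : Fin m} {p q : Fin n}
                   (p∈i : c p p ≡ i) (q∈j : c q q ≡ j) where
  open IsCoherent coh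
  open Quasiregular c coh qr

  σ : Fin m
  σ = c p q

  -- a path p −s→ l₀ −σ→ f₀ exhibiting an element c q f₀ of σ* s σ
  representative : ∀ {s} → InG c i s →
    Σ (Fin n) λ l₀ → Σ (Fin n) λ f₀ → c p l₀ ≡ s × c l₀ f₀ ≡ σ
  representative {s} s∈G =
    let (a₀ , b₀ , a₀b₀) = surj s
        (l₀ , pl₀) = extend {p} {a₀} {b₀} (trans p∈i (sym (proj₁ (s∈G a₀ b₀ a₀b₀))))
        l₀∈i = proj₂ (s∈G p l₀ (trans pl₀ a₀b₀))
        (f₀ , l₀f₀) = extend {l₀} {p} {q} (trans l₀∈i (sym p∈i))
    in l₀ , f₀ , trans pl₀ a₀b₀ , l₀f₀

  image-is-coset : ∀ s → InG c i s →
    Σ (Fin m) λ t → InG c j t × _≐_ c (Conj σ (Coset c i j s)) (Coset c j i t)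
  image-is-coset s s∈G with representative s∈G
  ... | l₀ , f₀ , pl₀ , l₀f₀ = c q f₀ , t∈G , ≐-by-pairs to from
    where
    l₀∈i : c l₀ l₀ ≡ i
    l₀∈i = proj₂ (s∈G p l₀ pl₀)

    t∈G : InG c j (c q f₀)
    t∈G x y xy = trans (source-fibre xy) q∈j ,
                 trans (target-fibre xy) (trans (target-fibre l₀f₀) q∈j)

    to : ∀ e f → Conj σ (Coset c i j s) (c e f) → Coset c j i (c q f₀) (c e f)
    to e f h =
      let (g , l , ge , Agl , lf) = conj-elim h
          (k , _ , k∈i , gk , kl) = coset-elim Agl
          e∈j = trans (target-fibre ge) q∈j
          ke = trans (sym (gk e e∈j)) ge
          pf₀≡kf = thin-composite (trans p∈i (sym l₀∈i)) (trans pl₀ (sym kl))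
                                  (trans l₀f₀ (sym lf))
          (e' , ke' , e'f) = path-transfer pf₀≡kf (q , refl , refl)
          ek≡e'k = transpose k e k e' (trans ke (sym ke'))
      in coset-intro e∈j (trans (target-fibre ke') q∈j) (agree-spread ek≡e'k k∈i) e'f

    from : ∀ e f → Coset c j i (c q f₀) (c e f) → Conj σ (Coset c i j s) (c e f)
    from e f h =
      let (e' , _ , _ , ee' , e'f) = coset-elim h
          (k , e'k , kf) = path-transfer (sym e'f) (p , refl , refl)
          (l , kl , lf) = path-transfer (sym kf) (l₀ , pl₀ , l₀f₀)
          k∈i = trans (target-fibre e'k) p∈i
          ke = transpose e k q p (trans (ee' k k∈i) e'k)
      in conj-intro ke (coset-intro k∈i k∈i agree-refl kl) lf

  conj-homomorphism : ∀ r s → InG c i r → InG c i s →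
    _≐_ c (Conj σ (Cplx c (Coset c i j r) (Coset c i j s)))
          (Cplx c (Conj σ (Coset c i j r)) (Conj σ (Coset c i j s)))
  conj-homomorphism r s _ _ = ≐-by-pairs to from
    where
    to : ∀ e f → Conj σ (Cplx c (Coset c i j r) (Coset c i j s)) (c e f) →
         Cplx c (Conj σ (Coset c i j r)) (Conj σ (Coset c i j s)) (c e f)
    to e f h =
      let (g , l , ge , ArAs , lf) = conj-elim h
          (k , Ar , As) = Cplx-elim {X = Coset c i j r} ArAs
          (_ , k∈i , _) = coset-elim As
          (w , kw) = extend {k} {p} {q} (trans k∈i (sym p∈i))
      in Cplx-intro (conj-intro ge Ar kw) (conj-intro kw As lf)

    from : ∀ e f → Cplx c (Conj σ (Coset c i j r)) (Conj σ (Coset c i j s)) (c e f) →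
           Conj σ (Cplx c (Coset c i j r) (Coset c i j s)) (c e f)
    from e f h =
      let (w , fAr , fAs) = Cplx-elim {X = Conj σ (Coset c i j r)} h
          (g , k , ge , Ar , kw) = conj-elim fAr
          (k' , l , k'w , As , lf) = conj-elim fAs
          k∈i = trans (source-fibre kw) p∈i
          l∈i = trans (source-fibre lf) p∈i
          kk' = agree-spread (trans kw (sym k'w)) (trans (target-fibre kw) q∈j)
          As' = coset-agree k∈i l∈i l∈i kk' agree-refl As
      in conj-intro ge (Cplx-intro {X = Coset c i j r} Ar As') lf

  conj-inverse : ∀ s → InG c i s →
    _≐_ c (Conj (c q p) (Conj σ (Coset c i j s))) (Coset c i j s)
  conj-inverse s s∈G = ≐-by-pairs to from
    where
    to : ∀ a b → Conj (c q p) (Conj σ (Coset c i j s)) (c a b) → Coset c i j s (c a b)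
    to a b h =
      let (g , h' , ga , fA , h'b) = conj-elim h
          (k , l , kg , As , lh') = conj-elim fA
          ak = agree-spread (trans (transpose g a q p ga) (sym kg))
                            (trans (source-fibre ga) q∈j)
          bl = agree-spread (trans (transpose h' b q p h'b) (sym lh'))
                            (trans (source-fibre h'b) q∈j)
      in coset-agree (trans (target-fibre ga) p∈i) (trans (target-fibre h'b) p∈i)
                     (trans (source-fibre lh') p∈i) ak bl As

    from : ∀ a b → Coset c i j s (c a b) → Conj (c q p) (Conj σ (Coset c i j s)) (c a b)
    from a b A =
      let (a∈i , b∈i) = coset-fibres s∈G A
          (g , ag) = extend {a} {p} {q} (trans a∈i (sym p∈i))
          (h' , bh') = extend {b} {p} {q} (trans b∈i (sym p∈i))
      in conj-intro (transpose a g p q ag) (conj-intro ag A bh') (transpose b h' p q bh')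

lemma4p2 : ∀ {n m : ℕ} (c : Colouring n m) → IsCoherent c → IsQuasiregular c →
    (α : Fin m → Fin n) → (∀ (i : Fin m) → IsFiber c i → c (α i) (α i) ≡ i) →
    ∀ (i j : Fin m) → IsFiber c i → IsFiber c j →
      (∀ (s : Fin m) → InG c i s →
         Σ (Fin m) λ t → InG c j t × _≐_ c (fmap c α i j (Coset c i j s)) (Coset c j i t))
    × (∀ (r s : Fin m) → InG c i r → InG c i s →
         _≐_ c (fmap c α i j (Cplx c (Coset c i j r) (Coset c i j s)))
               (Cplx c (fmap c α i j (Coset c i j r)) (fmap c α i j (Coset c i j s))))
    × (∀ (s : Fin m) → InG c i s →
         _≐_ c (fmap c α j i (fmap c α i j (Coset c i j s))) (Coset c i j s))
lemma4p2 c coh qr α hα i j i-fibre j-fibre =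
  image-is-coset , conj-homomorphism , conj-inverse
  where open Isomorphism c coh qr (hα i i-fibre) (hα j j-fibre)
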